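{- Let $G=(V,E_G)$ be the $d$-dimensional grid graph with side lengths $(n_1,\dots,n_d)$, and let $E,F\in V$ be two distinct non-adjacent vertices. Let $V_1=\{U\in V: d_G(U,E)\le d_G(U,F)\}$ and let $G_1$ be the subgraph of $G$ induced on $V_1$. Then $\beta(G_1)\le d$.
   Context: The $d$-dimensional grid graph with side lengths $(n_1,\dots,n_d)$ has vertices the integer vectors $(x^{(1)},\dots,x^{(d)})$ with $1\le x^{(i)}\le n_i$, two vertices adjacent iff they differ by exactly $1$ in exactly one coordinate. For a connected graph $H$, a set $R$ of vertices is resolving if every pair of distinct vertices $A\ne B$ has some $X\in R$ with $d_H(A,X)\ne d_H(B,X)$ ($d_H$ = shortest-path distance); the metric dimension $\beta(H)$ is the minimum size of a resolving set. -}

module Defs where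

open import Data.Nat using (ℕ; zero; suc; _≤_; ∣_-_∣)
open import Data.Fin using (Fin)
open import Data.Vec using (Vec; lookup)
open import Data.List using (List; length)
open import Data.List.Membership.Propositional using (_∈_)
open import Data.List.Relation.Unary.All using (All)
open import Data.Product using (Σ; ∃; _×_; _,_)
open import Relation.Binary.PropositionalEquality using (_≡_; _≢_)

Point : ℕ → Set
Point d = Vec ℕ d

InGrid : {d : ℕ} → Vec ℕ d → Point d → Set
InGrid {d} n x = (i : Fin d) → (1 ≤ lookup x i) × (lookup x i ≤ lookup n i)

Adj : {d : ℕ} → Point d → Point d → Set
Adj {d} A B = Σ (Fin d) λ i →
  (∣ lookup A i - lookup B i ∣ ≡ 1) × ((j : Fin d) → j ≢ i → lookup A j ≡ lookup B j)

data Walk {d : ℕ} (S : Point d → Set) : Point d → Point d → ℕ → Set where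
  here : ∀ {A} → S A → Walk S A A zero
  step : ∀ {A C B k} → S A → Adj A C → Walk S C B k → Walk S A B (suc k)

Dist : {d : ℕ} → (Point d → Set) → Point d → Point d → ℕ → Set
Dist S A B k = Walk S A B k × (∀ m → Walk S A B m → k ≤ m)

V₁ : {d : ℕ} → Vec ℕ d → Point d → Point d → Point d → Set
V₁ n E F U = InGrid n U × Σ ℕ λ k₁ → Σ ℕ λ k₂ →
  Dist (InGrid n) U E k₁ × Dist (InGrid n) U F k₂ × (k₁ ≤ k₂)

Resolving : {d : ℕ} → (Point d → Set) → List (Point d) → Set
Resolving S R = All S R ×
  (∀ A B → S A → S B → A ≢ B →
     Σ (Point _) λ X → (X ∈ R) × Σ ℕ λ k₁ → Σ ℕ λ k₂ →
       Dist S A X k₁ × Dist S B X k₂ × (k₁ ≢ k₂))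

MetricDimLe : {d : ℕ} → (Point d → Set) → ℕ → Set
MetricDimLe S m = Σ (List (Point _)) λ R → Resolving S R × (length R ≤ m)

-- Grid distance is taxicab distance, and so is distance inside V₁. Order the values of a
-- coordinate by how strongly they favour E over F (the preorder ≼). For U, W ∈ V₁ walk
-- from U to the pivot M whose i-th coordinate is the more E-favouring of Uᵢ and Wᵢ, then
-- on to W: every point of the first leg is coordinatewise ≼ U, every point of the second
-- is coordinatewise ≼ W, and such points stay in V₁.
--
-- For the resolving set take the corner c = base of the grid that is coordinatewise most
-- E-favouring, and for each direction j other than the first the landmark obtained by
-- moving c in direction j as far as possible within V₁. Every U ∈ V₁ lies between c and
-- that landmark in coordinate j, so the distances from U to c and to the landmark
-- determine |Uⱼ − cⱼ|, hence Uⱼ; the distance to c then also fixes the first coordinate.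

module Submission where

open import Defs
open import Data.Nat
open import Data.Nat.Properties
open import Algebra.Properties.CommutativeSemigroup +-commutativeSemigroup
  using (interchange; xy∙z≈zy∙x; x∙yz≈y∙xz)
open import Data.Sum using (_⊎_; inj₁; inj₂; [_,_]′)
open import Data.Product using (Σ; _×_; _,_; proj₁; proj₂)
open import Data.Empty using (⊥-elim)
open import Data.Fin using (Fin; zero; suc)
import Data.Fin.Properties as Fin
open import Data.Vec using (Vec; []; _∷_; lookup; tabulate; tail; _[_]≔_)
open import Data.Vec.Properties
  using (lookup∘tabulate; tabulate∘lookup; tabulate-cong; lookup∘update; lookup∘update′; []≔-lookup)
open import Data.List using (List; _∷_)
import Data.List as List
open import Data.List.Properties using (length-tabulate)
open import Data.List.Membership.Propositional using (find)
open import Data.List.Relation.Unary.All as All using (All; _∷_)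
open import Data.List.Relation.Unary.All.Properties using (tabulate⁺; tabulate⁻; ¬All⇒Any¬)
open import Function using (_∘_; id)
open import Relation.Binary.PropositionalEquality
open import Relation.Nullary using (¬_; yes; no; Dec)
open import Relation.Nullary.Decidable using (map′)
open import Relation.Unary using (Decidable)
open import Data.Nat.Tactic.RingSolver using (solve-∀)

InRange : ℕ → ℕ → Set
InRange m y = 1 ≤ y × y ≤ m

Between : ℕ → ℕ → ℕ → Set
Between a b y = (a ≤ y × y ≤ b) ⊎ (b ≤ y × y ≤ a)

between-left : ∀ a b → Between a b a
between-left a b with ≤-total a b
... | inj₁ a≤b = inj₁ (≤-refl , a≤b)
... | inj₂ b≤a = inj₂ (b≤a , ≤-refl)

between-right : ∀ a b → Between a b b
between-right a b with ≤-total a b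
... | inj₁ a≤b = inj₁ (a≤b , ≤-refl)
... | inj₂ b≤a = inj₂ (≤-refl , b≤a)

between-sym : ∀ {a b y} → Between a b y → Between b a y
between-sym (inj₁ a≤y≤b) = inj₂ a≤y≤b
between-sym (inj₂ b≤y≤a) = inj₁ b≤y≤a

between-self : ∀ {a y} → Between a a y → y ≡ a
between-self (inj₁ (a≤y , y≤a)) = ≤-antisym y≤a a≤y
between-self (inj₂ (a≤y , y≤a)) = ≤-antisym y≤a a≤y

between-InRange : ∀ {m a b y} → InRange m a → InRange m b → Between a b y → InRange m y
between-InRange (1≤a , _) (_ , b≤m) (inj₁ (a≤y , y≤b)) = ≤-trans 1≤a a≤y , ≤-trans y≤b b≤m
between-InRange (_ , a≤m) (1≤b , _) (inj₂ (b≤y , y≤a)) = ≤-trans 1≤b b≤y , ≤-trans y≤a a≤m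

∣-∣-additive : ∀ {a y b} → a ≤ y → y ≤ b → ∣ a - y ∣ + ∣ y - b ∣ ≡ ∣ a - b ∣
∣-∣-additive z≤n y≤b = trans (cong (_ +_) (m≤n⇒∣m-n∣≡n∸m y≤b)) (m+[n∸m]≡n y≤b)
∣-∣-additive (s≤s a≤y) (s≤s y≤b) = ∣-∣-additive a≤y y≤b

between⇒∣-∣-additive : ∀ {a b y} → Between a b y → ∣ y - a ∣ + ∣ y - b ∣ ≡ ∣ a - b ∣
between⇒∣-∣-additive {a} {b} {y} (inj₁ (a≤y , y≤b)) =
  trans (cong (_+ ∣ y - b ∣) (∣-∣-comm y a)) (∣-∣-additive a≤y y≤b)
between⇒∣-∣-additive {a} {b} {y} (inj₂ (b≤y , y≤a)) = begin
  ∣ y - a ∣ + ∣ y - b ∣ ≡⟨ +-comm ∣ y - a ∣ _ ⟩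
  ∣ y - b ∣ + ∣ y - a ∣ ≡⟨ cong (_+ ∣ y - a ∣) (∣-∣-comm y b) ⟩
  ∣ b - y ∣ + ∣ y - a ∣ ≡⟨ ∣-∣-additive b≤y y≤a ⟩
  ∣ b - a ∣             ≡⟨ ∣-∣-comm b a ⟩
  ∣ a - b ∣             ∎
  where open ≡-Reasoning

∣n-1+n∣≡1 : ∀ n → ∣ n - suc n ∣ ≡ 1
∣n-1+n∣≡1 zero    = refl
∣n-1+n∣≡1 (suc n) = ∣n-1+n∣≡1 n

lookup-ext : ∀ {d} {A B : Vec ℕ d} → (∀ i → lookup A i ≡ lookup B i) → A ≡ B
lookup-ext {A = A} {B} A≗B =
  trans (sym (tabulate∘lookup A)) (trans (tabulate-cong A≗B) (tabulate∘lookup B))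

+-cancel-crosswise : ∀ {l c a b a′ b′} →
  l + a ≡ c + b → l + a′ ≡ c + b′ → a + b ≡ a′ + b′ → a ≡ a′
+-cancel-crosswise {l} {c} eq eq′ sum =
  ≤-antisym (≮⇒≥ (impossible eq′ eq (sym sum))) (≮⇒≥ (impossible eq eq′ sum))
  where
    impossible : ∀ {a b a′ b′} → l + a ≡ c + b → l + a′ ≡ c + b′ → a + b ≡ a′ + b′ → ¬ a < a′
    impossible {a} {b} {a′} {b′} eq eq′ sum a<a′ = <-irrefl refl (begin-strict
      l + a  <⟨ +-monoʳ-< l a<a′ ⟩
      l + a′ ≡⟨ eq′ ⟩
      c + b′ <⟨ +-monoʳ-< c b′<b ⟩
      c + b  ≡⟨ eq ⟨
      l + a  ∎)
      where
        open ≤-Reasoning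
        b′<b : b′ < b
        b′<b = ≰⇒> λ b≤b′ → <-irrefl sum (+-mono-<-≤ a<a′ b≤b′)

-- Taxicab distance and grid walks

taxicab : ∀ {d} → Point d → Point d → ℕ
taxicab []      []      = 0
taxicab (a ∷ A) (b ∷ B) = ∣ a - b ∣ + taxicab A B

taxicab-self : ∀ {d} (A : Point d) → taxicab A A ≡ 0
taxicab-self []      = refl
taxicab-self (a ∷ A) = cong₂ _+_ (∣n-n∣≡0 a) (taxicab-self A)

taxicab-triangle : ∀ {d} (A B C : Point d) → taxicab A C ≤ taxicab A B + taxicab B C
taxicab-triangle []      []      []      = ≤-refl
taxicab-triangle (a ∷ A) (b ∷ B) (c ∷ C) = begin
  ∣ a - c ∣ + taxicab A C
    ≤⟨ +-mono-≤ (∣-∣-triangle a b c) (taxicab-triangle A B C) ⟩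
  (∣ a - b ∣ + ∣ b - c ∣) + (taxicab A B + taxicab B C)
    ≡⟨ interchange ∣ a - b ∣ _ _ _ ⟩
  (∣ a - b ∣ + taxicab A B) + (∣ b - c ∣ + taxicab B C) ∎
  where open ≤-Reasoning

taxicab-update : ∀ {d} (U C : Point d) j x →
  taxicab U (C [ j ]≔ x) + ∣ lookup U j - lookup C j ∣ ≡ taxicab U C + ∣ lookup U j - x ∣
taxicab-update (u ∷ U) (c ∷ C) zero    x = xy∙z≈zy∙x ∣ u - x ∣ (taxicab U C) ∣ u - c ∣
taxicab-update (u ∷ U) (c ∷ C) (suc j) x = begin
  (∣ u - c ∣ + taxicab U (C [ j ]≔ x)) + ∣ lookup U j - lookup C j ∣ ≡⟨ +-assoc ∣ u - c ∣ _ _ ⟩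
  ∣ u - c ∣ + (taxicab U (C [ j ]≔ x) + ∣ lookup U j - lookup C j ∣) ≡⟨ cong (∣ u - c ∣ +_) IH ⟩
  ∣ u - c ∣ + (taxicab U C + ∣ lookup U j - x ∣)                     ≡⟨ +-assoc ∣ u - c ∣ _ _ ⟨
  (∣ u - c ∣ + taxicab U C) + ∣ lookup U j - x ∣                     ∎
  where
    open ≡-Reasoning
    IH : taxicab U (C [ j ]≔ x) + ∣ lookup U j - lookup C j ∣ ≡ taxicab U C + ∣ lookup U j - x ∣
    IH = taxicab-update U C j x

Box : ∀ {d} → Point d → Point d → Point d → Set
Box A B Y = ∀ i → Between (lookup A i) (lookup B i) (lookup Y i)

box⇒taxicab-additive : ∀ {d} (A B Y : Point d) → Box A B Y → taxicab A Y + taxicab Y B ≡ taxicab A B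
box⇒taxicab-additive []      []      []      _     = refl
box⇒taxicab-additive (a ∷ A) (b ∷ B) (y ∷ Y) AYB = begin
  (∣ a - y ∣ + taxicab A Y) + (∣ y - b ∣ + taxicab Y B) ≡⟨ interchange ∣ a - y ∣ _ _ _ ⟩
  (∣ a - y ∣ + ∣ y - b ∣) + (taxicab A Y + taxicab Y B)
    ≡⟨ cong₂ _+_ ayb (box⇒taxicab-additive A B Y (AYB ∘ suc)) ⟩
  ∣ a - b ∣ + taxicab A B                               ∎
  where
    open ≡-Reasoning
    ayb : ∣ a - y ∣ + ∣ y - b ∣ ≡ ∣ a - b ∣
    ayb = trans (cong (_+ ∣ y - b ∣) (∣-∣-comm a y)) (between⇒∣-∣-additive (AYB zero))

box-InGrid : ∀ {d} {n A B Y : Point d} → InGrid n A → InGrid n B → Box A B Y → InGrid n Y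
box-InGrid A∈ B∈ AYB i = between-InRange (A∈ i) (B∈ i) (AYB i)

Adj⇒taxicab≡1 : ∀ {d} {A B : Point d} → Adj A B → taxicab A B ≡ 1
Adj⇒taxicab≡1 {A = a ∷ A} {b ∷ B} (zero , a~b , same) =
  cong₂ _+_ a~b (trans (cong (λ X → taxicab X B) A≡B) (taxicab-self B))
  where
    A≡B : A ≡ B
    A≡B = lookup-ext λ j → same (suc j) λ ()
Adj⇒taxicab≡1 {A = a ∷ A} {b ∷ B} (suc i , Ai~Bi , same) =
  cong₂ _+_ (m≡n⇒∣m-n∣≡0 {a} (same zero λ ())) (Adj⇒taxicab≡1 {A = A} {B} A~B)
  where
    A~B : Adj A B
    A~B = i , Ai~Bi , λ j j≢i → same (suc j) (j≢i ∘ Fin.suc-injective)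

Adj-head : ∀ {d a b} (X : Point d) → ∣ a - b ∣ ≡ 1 → Adj (a ∷ X) (b ∷ X)
Adj-head X a~b = zero , a~b , λ { zero 0≢0 → ⊥-elim (0≢0 refl) ; (suc j) _ → refl }

Adj-cons : ∀ {d} b {A B : Point d} → Adj A B → Adj (b ∷ A) (b ∷ B)
Adj-cons b (i , Ai~Bi , same) =
  suc i , Ai~Bi , λ { zero _ → refl ; (suc j) j≢i → same j (j≢i ∘ cong suc) }

taxicab≤length : ∀ {d} {S : Point d → Set} {A B k} → Walk S A B k → taxicab A B ≤ k
taxicab≤length {A = A} (here _) = ≤-reflexive (taxicab-self A)
taxicab≤length {A = A} {B} (step {C = C} _ A~C w) = begin
  taxicab A B               ≤⟨ taxicab-triangle A C B ⟩
  taxicab A C + taxicab C B ≡⟨ cong (_+ taxicab C B) (Adj⇒taxicab≡1 {A = A} {C} A~C) ⟩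
  suc (taxicab C B)         ≤⟨ s≤s (taxicab≤length w) ⟩
  suc _                     ∎
  where open ≤-Reasoning

geodesic⇒Dist : ∀ {d} {S : Point d → Set} {A B} → Walk S A B (taxicab A B) → Dist S A B (taxicab A B)
geodesic⇒Dist w = w , λ _ → taxicab≤length

_++ʷ_ : ∀ {d} {S : Point d → Set} {A B C k l} → Walk S A B k → Walk S B C l → Walk S A C (k + l)
here _       ++ʷ w′ = w′
step s A~C w ++ʷ w′ = step s A~C (w ++ʷ w′)

mapʷ : ∀ {d} {S T : Point d → Set} {A B k} → (∀ {X} → S X → T X) → Walk S A B k → Walk T A B k
mapʷ S⊆T (here s)       = here (S⊆T s)
mapʷ S⊆T (step s A~C w) = step (S⊆T s) A~C (mapʷ S⊆T w)

consʷ : ∀ {d} {S : Point (suc d) → Set} b {A B : Point d} {k} →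
  Walk (λ Y → S (b ∷ Y)) A B k → Walk S (b ∷ A) (b ∷ B) k
consʷ b (here s)       = here s
consʷ b (step s A~C w) = step s (Adj-cons b A~C) (consʷ b w)

ascending : ∀ {d} {S : Point (suc d) → Set} (X : Point d) k a →
  (∀ y → a ≤ y → y ≤ k + a → S (y ∷ X)) → Walk S (a ∷ X) (k + a ∷ X) k
ascending X zero    a inS = here (inS a ≤-refl ≤-refl)
ascending {S = S} X (suc k) a inS =
  step (inS a ≤-refl (m≤n+m a (suc k))) (Adj-head X (∣n-1+n∣≡1 a))
    (subst (λ b → Walk S (suc a ∷ X) (b ∷ X) k) (+-suc k a)
      (ascending X k (suc a) λ y a<y y≤ → inS y (<⇒≤ a<y) (subst (y ≤_) (+-suc k a) y≤)))

descending : ∀ {d} {S : Point (suc d) → Set} (X : Point d) k a →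
  (∀ y → a ≤ y → y ≤ k + a → S (y ∷ X)) → Walk S (k + a ∷ X) (a ∷ X) k
descending X zero    a inS = here (inS a ≤-refl ≤-refl)
descending X (suc k) a inS =
  step (inS (suc k + a) (m≤n+m a (suc k)) ≤-refl)
    (Adj-head X (trans (∣-∣-comm (suc (k + a)) (k + a)) (∣n-1+n∣≡1 (k + a))))
    (descending X k a λ y a≤y y≤ → inS y a≤y (m≤n⇒m≤1+n y≤))

line-walk : ∀ {d} {S : Point (suc d) → Set} (X : Point d) a b →
  (∀ y → Between a b y → S (y ∷ X)) → Walk S (a ∷ X) (b ∷ X) ∣ a - b ∣
line-walk {S = S} X a b inS with ≤-total a b
... | inj₁ a≤b =
  subst₂ (λ b′ k → Walk S (a ∷ X) (b′ ∷ X) k) (m∸n+n≡m a≤b) (sym (m≤n⇒∣m-n∣≡n∸m a≤b))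
    (ascending X (b ∸ a) a λ y a≤y y≤ → inS y (inj₁ (a≤y , subst (y ≤_) (m∸n+n≡m a≤b) y≤)))
... | inj₂ b≤a =
  subst₂ (λ a′ k → Walk S (a′ ∷ X) (b ∷ X) k) (m∸n+n≡m b≤a) (sym (m≤n⇒∣n-m∣≡n∸m b≤a))
    (descending X (a ∸ b) b λ y b≤y y≤ → inS y (inj₂ (b≤y , subst (y ≤_) (m∸n+n≡m b≤a) y≤)))

box-walk : ∀ {d} {S : Point d → Set} (A B : Point d) → (∀ Y → Box A B Y → S Y) → Walk S A B (taxicab A B)
box-walk []      []      inS = here (inS [] λ ())
box-walk (a ∷ A) (b ∷ B) inS =
  line-walk A a b (λ y ayb → inS (y ∷ A) λ { zero → ayb ; (suc i) → between-left _ (lookup B i) })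
  ++ʷ consʷ b (box-walk A B λ Y AYB → inS (b ∷ Y) λ { zero → between-right a b ; (suc i) → AYB i })

grid-Dist : ∀ {d} {n A B : Point d} → InGrid n A → InGrid n B → Dist (InGrid n) A B (taxicab A B)
grid-Dist {n = n} {A} {B} A∈ B∈ = geodesic⇒Dist (box-walk A B λ Y → box-InGrid {n = n} {A} {B} {Y} A∈ B∈)

-- Coordinates favouring E

-- y ≼⟨ e , f ⟩ x means |y − e| − |y − f| ≤ |x − e| − |x − f|, stated without subtraction.
record _≼⟨_,_⟩_ (y e f x : ℕ) : Set where
  constructor ≼⁺
  field ≼⁻ : ∣ y - e ∣ + ∣ x - f ∣ ≤ ∣ x - e ∣ + ∣ y - f ∣

open _≼⟨_,_⟩_

≼-dec : ∀ y e f x → Dec (y ≼⟨ e , f ⟩ x)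
≼-dec y e f x = map′ ≼⁺ ≼⁻ (_ ≤? _)

≼-refl : ∀ {e f y} → y ≼⟨ e , f ⟩ y
≼-refl = ≼⁺ ≤-refl

≼-trans : ∀ {e f z y x} → z ≼⟨ e , f ⟩ y → y ≼⟨ e , f ⟩ x → z ≼⟨ e , f ⟩ x
≼-trans {e} {f} {z} {y} {x} (≼⁺ z≼y) (≼⁺ y≼x) = ≼⁺ (+-cancelʳ-≤ (∣ y - e ∣ + ∣ y - f ∣) _ _ (begin
  (∣ z - e ∣ + ∣ x - f ∣) + (∣ y - e ∣ + ∣ y - f ∣) ≡⟨ swap₂₄ ∣ z - e ∣ ∣ x - f ∣ ∣ y - e ∣ ∣ y - f ∣ ⟩
  (∣ z - e ∣ + ∣ y - f ∣) + (∣ y - e ∣ + ∣ x - f ∣) ≤⟨ +-mono-≤ z≼y y≼x ⟩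
  (∣ y - e ∣ + ∣ z - f ∣) + (∣ x - e ∣ + ∣ y - f ∣) ≡⟨ swap₁₃ ∣ y - e ∣ ∣ z - f ∣ ∣ x - e ∣ ∣ y - f ∣ ⟩
  (∣ x - e ∣ + ∣ z - f ∣) + (∣ y - e ∣ + ∣ y - f ∣) ∎))
  where
    open ≤-Reasoning
    swap₂₄ : ∀ a b c d → (a + b) + (c + d) ≡ (a + d) + (c + b)
    swap₂₄ = solve-∀
    swap₁₃ : ∀ a b c d → (a + b) + (c + d) ≡ (c + b) + (a + d)
    swap₁₃ = solve-∀

≼-swap : ∀ {e f y x} → x ≼⟨ f , e ⟩ y → y ≼⟨ e , f ⟩ x
≼-swap {e} {f} {y} {x} (≼⁺ x≼y) =
  ≼⁺ (subst₂ _≤_ (+-comm ∣ x - f ∣ ∣ y - e ∣) (+-comm ∣ y - f ∣ ∣ x - e ∣) x≼y)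

≼-dual : ∀ {e f y x} → e ≼⟨ y , x ⟩ f → y ≼⟨ e , f ⟩ x
≼-dual {e} {f} {y} {x} (≼⁺ e≼f) = ≼⁺ (subst₂ _≤_
  (cong₂ _+_ (∣-∣-comm e y) (∣-∣-comm f x))
  (trans (+-comm ∣ f - y ∣ ∣ e - x ∣) (cong₂ _+_ (∣-∣-comm e x) (∣-∣-comm f y)))
  e≼f)

zero-≼ : ∀ {e f} x → e ≤ f → 0 ≼⟨ e , f ⟩ x
zero-≼ {e} {f} x e≤f = ≼⁺ (begin
  e + ∣ x - f ∣               ≤⟨ +-monoʳ-≤ e (∣-∣-triangle x e f) ⟩
  e + (∣ x - e ∣ + ∣ e - f ∣) ≡⟨ x∙yz≈y∙xz e ∣ x - e ∣ ∣ e - f ∣ ⟩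
  ∣ x - e ∣ + (e + ∣ e - f ∣) ≡⟨ cong (λ t → ∣ x - e ∣ + (e + t)) (m≤n⇒∣m-n∣≡n∸m e≤f) ⟩
  ∣ x - e ∣ + (e + (f ∸ e))   ≡⟨ cong (∣ x - e ∣ +_) (m+[n∸m]≡n e≤f) ⟩
  ∣ x - e ∣ + f               ∎)
  where open ≤-Reasoning

≤⇒≼ : ∀ {e f y x} → e ≤ f → y ≤ x → y ≼⟨ e , f ⟩ x
≤⇒≼ {y = zero}  {x} e≤f _   = zero-≼ x e≤f
≤⇒≼ {zero} {f} {suc y} {x} _ y≤x = ≼-dual (zero-≼ f y≤x)
≤⇒≼ {suc e} {suc f} {suc y} {suc x} (s≤s e≤f) (s≤s y≤x) = ≼⁺ (≼⁻ (≤⇒≼ e≤f y≤x))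

≥⇒≼ : ∀ {e f y x} → f ≤ e → x ≤ y → y ≼⟨ e , f ⟩ x
≥⇒≼ f≤e x≤y = ≼-swap (≤⇒≼ f≤e x≤y)

between⇒≼⊎≼ : ∀ {e f a b y} → Between a b y → y ≼⟨ e , f ⟩ a ⊎ y ≼⟨ e , f ⟩ b
between⇒≼⊎≼ {e} {f} (inj₁ (a≤y , y≤b)) with ≤-total e f
... | inj₁ e≤f = inj₂ (≤⇒≼ e≤f y≤b)
... | inj₂ f≤e = inj₁ (≥⇒≼ f≤e a≤y)
between⇒≼⊎≼ {e} {f} (inj₂ (b≤y , y≤a)) with ≤-total e f
... | inj₁ e≤f = inj₁ (≤⇒≼ e≤f y≤a)
... | inj₂ f≤e = inj₂ (≥⇒≼ f≤e b≤y)

_≼*⟨_,_⟩_ : ∀ {d} → Point d → Point d → Point d → Point d → Set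
Y ≼*⟨ E , F ⟩ U = ∀ i → lookup Y i ≼⟨ lookup E i , lookup F i ⟩ lookup U i

≼*⇒taxicab : ∀ {d} (E F Y U : Point d) → Y ≼*⟨ E , F ⟩ U →
  taxicab Y E + taxicab U F ≤ taxicab U E + taxicab Y F
≼*⇒taxicab []      []      []      []      _   = ≤-refl
≼*⇒taxicab (e ∷ E) (f ∷ F) (y ∷ Y) (u ∷ U) Y≼U = begin
  (∣ y - e ∣ + taxicab Y E) + (∣ u - f ∣ + taxicab U F) ≡⟨ interchange ∣ y - e ∣ _ _ _ ⟩
  (∣ y - e ∣ + ∣ u - f ∣) + (taxicab Y E + taxicab U F)
    ≤⟨ +-mono-≤ (≼⁻ (Y≼U zero)) (≼*⇒taxicab E F Y U (Y≼U ∘ suc)) ⟩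
  (∣ u - e ∣ + ∣ y - f ∣) + (taxicab U E + taxicab Y F) ≡⟨ interchange ∣ u - e ∣ _ _ _ ⟩
  (∣ u - e ∣ + taxicab U E) + (∣ y - f ∣ + taxicab Y F) ∎
  where open ≤-Reasoning

≼*-nearer : ∀ {d} {E F Y U : Point d} → Y ≼*⟨ E , F ⟩ U →
  taxicab U E ≤ taxicab U F → taxicab Y E ≤ taxicab Y F
≼*-nearer {E = E} {F} {Y} {U} Y≼U U-near = +-cancelʳ-≤ (taxicab U F) _ _ (begin
  taxicab Y E + taxicab U F ≤⟨ ≼*⇒taxicab E F Y U Y≼U ⟩
  taxicab U E + taxicab Y F ≤⟨ +-monoˡ-≤ (taxicab Y F) U-near ⟩
  taxicab U F + taxicab Y F ≡⟨ +-comm (taxicab U F) _ ⟩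
  taxicab Y F + taxicab U F ∎)
  where open ≤-Reasoning

pivot : ℕ → ℕ → ℕ → ℕ → ℕ
pivot e f u w with ≼-dec w e f u
... | yes _ = w
... | no  _ = u

pivot-between : ∀ e f u w → Between u w (pivot e f u w)
pivot-between e f u w with ≼-dec w e f u
... | yes _ = between-right u w
... | no  _ = between-left u w

pivot-left : ∀ {e f u w y} → Between u (pivot e f u w) y → y ≼⟨ e , f ⟩ u
pivot-left {e} {f} {u} {w} uyp with ≼-dec w e f u
... | yes w≼u = [ id , (λ y≼w → ≼-trans y≼w w≼u) ]′ (between⇒≼⊎≼ uyp)
... | no  _   = subst (λ y → y ≼⟨ e , f ⟩ u) (sym (between-self uyp)) ≼-refl

pivot-right : ∀ {e f u w y} → Between (pivot e f u w) w y → y ≼⟨ e , f ⟩ w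
pivot-right {e} {f} {u} {w} pyw with ≼-dec w e f u
... | yes _   = subst (λ y → y ≼⟨ e , f ⟩ w) (sym (between-self (between-sym pyw))) ≼-refl
... | no  w⋠u = [ (λ y≼u → ≼-trans y≼u (≼⁺ (≰⇒≥ (w⋠u ∘ ≼⁺)))) , id ]′ (between⇒≼⊎≼ pyw)

pivotPoint : ∀ {d} → Point d → Point d → Point d → Point d → Point d
pivotPoint E F U W = tabulate λ i → pivot (lookup E i) (lookup F i) (lookup U i) (lookup W i)

module _ {d} (E F U W : Point d) where

  lookup-pivotPoint : ∀ i →
    lookup (pivotPoint E F U W) i ≡ pivot (lookup E i) (lookup F i) (lookup U i) (lookup W i)
  lookup-pivotPoint = lookup∘tabulate _

  pivotPoint-box : Box U W (pivotPoint E F U W)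
  pivotPoint-box i = subst (Between _ _) (sym (lookup-pivotPoint i)) (pivot-between _ _ _ _)

  pivotPoint-first-leg : ∀ Y → Box U (pivotPoint E F U W) Y → Y ≼*⟨ E , F ⟩ U
  pivotPoint-first-leg Y UYM i =
    pivot-left {w = lookup W i} (subst (λ m → Between _ m _) (lookup-pivotPoint i) (UYM i))

  pivotPoint-second-leg : ∀ Y → Box (pivotPoint E F U W) W Y → Y ≼*⟨ E , F ⟩ W
  pivotPoint-second-leg Y MYW i =
    pivot-right {u = lookup U i} (subst (λ m → Between m _ _) (lookup-pivotPoint i) (MYW i))

-- Geodesics inside V₁

module HalfGrid {d} (n E F : Point d) (E∈ : InGrid n E) (F∈ : InGrid n F) where

  Nearer : Point d → Set
  Nearer U = taxicab U E ≤ taxicab U F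

  record TaxicabV₁ (U : Point d) : Set where
    constructor _,_
    field
      inGrid : InGrid n U
      nearer : Nearer U

  open TaxicabV₁ public

  V₁⇒TaxicabV₁ : ∀ {U} → V₁ n E F U → TaxicabV₁ U
  V₁⇒TaxicabV₁ {U} (U∈ , k₁ , k₂ , (toE , _) , (_ , toF-shortest) , k₁≤k₂) = U∈ , (begin
    taxicab U E ≤⟨ taxicab≤length toE ⟩
    k₁          ≤⟨ k₁≤k₂ ⟩
    k₂          ≤⟨ toF-shortest _ (proj₁ (grid-Dist {n = n} {U} {F} U∈ F∈)) ⟩
    taxicab U F ∎)
    where open ≤-Reasoning

  TaxicabV₁⇒V₁ : ∀ {U} → TaxicabV₁ U → V₁ n E F U
  TaxicabV₁⇒V₁ {U} (U∈ , U-near) =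
    U∈ , taxicab U E , taxicab U F ,
    grid-Dist {n = n} {U} {E} U∈ E∈ , grid-Dist {n = n} {U} {F} U∈ F∈ , U-near

  ≼*-TaxicabV₁ : ∀ {U} Y → InGrid n Y → Y ≼*⟨ E , F ⟩ U → TaxicabV₁ U → TaxicabV₁ Y
  ≼*-TaxicabV₁ {U} Y Y∈ Y≼U U∈ = Y∈ , ≼*-nearer {E = E} {F} {Y} {U} Y≼U (nearer U∈)

  TaxicabV₁-geodesic : ∀ {U W} → TaxicabV₁ U → TaxicabV₁ W → Walk TaxicabV₁ U W (taxicab U W)
  TaxicabV₁-geodesic {U} {W} U∈ W∈ =
    subst (Walk TaxicabV₁ U W) (box⇒taxicab-additive U W M (pivotPoint-box E F U W))
      (box-walk U M (λ Y UYM → ≼*-TaxicabV₁ Y (box-InGrid {n = n} {U} {M} {Y} (inGrid U∈) M∈ UYM)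
                                               (pivotPoint-first-leg E F U W Y UYM) U∈)
       ++ʷ box-walk M W (λ Y MYW → ≼*-TaxicabV₁ Y (box-InGrid {n = n} {M} {W} {Y} M∈ (inGrid W∈) MYW)
                                                  (pivotPoint-second-leg E F U W Y MYW) W∈))
    where
      M : Point d
      M = pivotPoint E F U W
      M∈ : InGrid n M
      M∈ = box-InGrid {n = n} {U} {W} {M} (inGrid U∈) (inGrid W∈) (pivotPoint-box E F U W)

  V₁-Dist : ∀ {A B} → V₁ n E F A → V₁ n E F B → Dist (V₁ n E F) A B (taxicab A B)
  V₁-Dist A∈ B∈ =
    geodesic⇒Dist (mapʷ TaxicabV₁⇒V₁ (TaxicabV₁-geodesic (V₁⇒TaxicabV₁ A∈) (V₁⇒TaxicabV₁ B∈)))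

-- Farthest points from an end of [1, m]

data Endpoint (m : ℕ) : ℕ → Set where
  low  : Endpoint m 1
  high : Endpoint m m

endpoint-InRange : ∀ {m c} → Endpoint m c → 1 ≤ m → InRange m c
endpoint-InRange low  1≤m = ≤-refl , 1≤m
endpoint-InRange high 1≤m = 1≤m , ≤-refl

inward : ∀ {m c} → Endpoint m c → ℕ → ℕ
inward     low  t = suc t
inward {m} high t = m ∸ t

inward-zero : ∀ {m c} (ep : Endpoint m c) → inward ep 0 ≡ c
inward-zero low  = refl
inward-zero high = refl

inward-InRange : ∀ {m c t} (ep : Endpoint m c) → 1 ≤ m → t ≤ m ∸ 1 → InRange m (inward ep t)
inward-InRange low (s≤s _) t≤m-1 = s≤s z≤n , s≤s t≤m-1
inward-InRange {m} {t = t} high 1≤m t≤m-1 = 1≤m-t , m∸n≤m m t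
  where
    1≤m-t : 1 ≤ m ∸ t
    1≤m-t = ≤-trans (≤-reflexive (sym (m∸[m∸n]≡n 1≤m))) (∸-monoʳ-≤ m t≤m-1)

inward-∣-∣ : ∀ {m c y} (ep : Endpoint m c) → InRange m y → inward ep ∣ y - c ∣ ≡ y
inward-∣-∣ {y = suc y} low  _          = cong suc (∣-∣-identityʳ y)
inward-∣-∣ {m}         high (_ , y≤m) = trans (cong (m ∸_) (m≤n⇒∣m-n∣≡n∸m y≤m)) (m∸[m∸n]≡n y≤m)

∣-∣≤m∸1 : ∀ {m c y} (ep : Endpoint m c) → InRange m y → ∣ y - c ∣ ≤ m ∸ 1
∣-∣≤m∸1 {m} {y = suc y} low  (_ , y<m)   = subst (_≤ m ∸ 1) (sym (∣-∣-identityʳ y)) (∸-monoˡ-≤ 1 y<m)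
∣-∣≤m∸1 {m}             high (1≤y , y≤m) = subst (_≤ m ∸ 1) (sym (m≤n⇒∣m-n∣≡n∸m y≤m)) (∸-monoʳ-≤ m 1≤y)

inward-between : ∀ {m c s t} (ep : Endpoint m c) → t ≤ s → Between c (inward ep s) (inward ep t)
inward-between     low  t≤s = inj₁ (s≤s z≤n , s≤s t≤s)
inward-between {m} {t = t} high t≤s = inj₂ (∸-monoʳ-≤ m t≤s , m∸n≤m m t)

endpoint-injective : ∀ {m c u w} (ep : Endpoint m c) → InRange m u → InRange m w →
  ∣ u - c ∣ ≡ ∣ w - c ∣ → u ≡ w
endpoint-injective ep u∈ w∈ eq =
  trans (sym (inward-∣-∣ ep u∈)) (trans (cong (inward ep) eq) (inward-∣-∣ ep w∈))

largest : (P : ℕ → Set) → Decidable P → ∀ k → P 0 →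
  Σ ℕ λ s → s ≤ k × P s × (∀ {t} → t ≤ k → P t → t ≤ s)
largest P P? zero    P0 = 0 , z≤n , P0 , λ t≤0 _ → t≤0
largest P P? (suc k) P0 with P? (suc k) | largest P P? k P0
... | yes P1+k | _                  = suc k , ≤-refl , P1+k , λ t≤1+k _ → t≤1+k
... | no ¬P1+k | s , s≤k , Ps , max =
  s , m≤n⇒m≤1+n s≤k , Ps , λ t≤1+k Pt → max (s≤s⁻¹ (≤∧≢⇒< t≤1+k λ { refl → ¬P1+k Pt })) Pt

record Farthest (m c : ℕ) (P : ℕ → Set) : Set where
  constructor farthest-point
  field
    far         : ℕ
    far-InRange : InRange m far
    far-holds   : P far
    far-bounds  : ∀ {y} → InRange m y → P y → Between c far y

open Farthest

farthest : ∀ {m c} → Endpoint m c → 1 ≤ m → (P : ℕ → Set) → Decidable P → P c → Farthest m c P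
farthest {m} {c} ep 1≤m P P? Pc
  with largest (P ∘ inward ep) (P? ∘ inward ep) (m ∸ 1) (subst P (sym (inward-zero ep)) Pc)
... | s , s≤m-1 , Ps , max = farthest-point (inward ep s) (inward-InRange ep 1≤m s≤m-1) Ps λ y∈ Py →
  subst (Between c (inward ep s)) (inward-∣-∣ ep y∈)
    (inward-between ep (max (∣-∣≤m∸1 ep y∈) (subst P (sym (inward-∣-∣ ep y∈)) Py)))

corner : ℕ → ℕ → ℕ → ℕ
corner e f m with e ≤? f
... | yes _ = 1
... | no  _ = m

corner-endpoint : ∀ e f m → Endpoint m (corner e f m)
corner-endpoint e f m with e ≤? f
... | yes _ = low
... | no  _ = high

corner-≼ : ∀ {e f m y} → InRange m y → corner e f m ≼⟨ e , f ⟩ y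
corner-≼ {e} {f} (1≤y , y≤m) with e ≤? f
... | yes e≤f = ≤⇒≼ e≤f 1≤y
... | no  e≰f = ≥⇒≼ (≰⇒≥ e≰f) y≤m

-- The resolving set

separating-list-resolves : ∀ {d} {S : Point d → Set} (R : List (Point d)) → All S R →
  (∀ {A B} → S A → S B → Dist S A B (taxicab A B)) →
  (∀ {A B} → S A → S B → All (λ X → taxicab A X ≡ taxicab B X) R → A ≡ B) →
  Resolving S R
separating-list-resolves R R⊆S dist separates = R⊆S , λ A B A∈ B∈ A≢B →
  let X , X∈R , A≁B = find (¬All⇒Any¬ (λ X → taxicab A X ≟ taxicab B X) R (A≢B ∘ separates A∈ B∈))
      X∈S = All.lookup R⊆S X∈R
  in X , X∈R , taxicab A X , taxicab B X , dist A∈ X∈S , dist B∈ X∈S , A≁B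

module Landmarks {d} (n E F : Point (suc d)) (E∈ : InGrid n E) (F∈ : InGrid n F) where
  open HalfGrid n E F E∈ F∈

  base : Point (suc d)
  base = tabulate λ i → corner (lookup E i) (lookup F i) (lookup n i)

  lookup-base : ∀ i → lookup base i ≡ corner (lookup E i) (lookup F i) (lookup n i)
  lookup-base = lookup∘tabulate _

  1≤n : ∀ i → 1 ≤ lookup n i
  1≤n i = ≤-trans (proj₁ (E∈ i)) (proj₂ (E∈ i))

  base-endpoint : ∀ i → Endpoint (lookup n i) (lookup base i)
  base-endpoint i = subst (Endpoint _) (sym (lookup-base i)) (corner-endpoint _ _ _)

  update-InGrid : ∀ {X} j {x} → InGrid n X → InRange (lookup n j) x → InGrid n (X [ j ]≔ x)
  update-InGrid {X} j {x} X∈ x∈ i with i Fin.≟ j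
  ... | yes refl = subst (InRange _) (sym (lookup∘update i X x)) x∈
  ... | no  i≢j  = subst (InRange _) (sym (lookup∘update′ i≢j X x)) (X∈ i)

  base-≼* : ∀ {U} → InGrid n U → base ≼*⟨ E , F ⟩ U
  base-≼* {U} U∈ i = subst (λ y → y ≼⟨ _ , _ ⟩ lookup U i) (sym (lookup-base i)) (corner-≼ (U∈ i))

  update-base-≼* : ∀ {U} → InGrid n U → ∀ j → (base [ j ]≔ lookup U j) ≼*⟨ E , F ⟩ U
  update-base-≼* {U} U∈ j i with i Fin.≟ j
  ... | yes refl = subst (λ y → y ≼⟨ _ , _ ⟩ lookup U i) (sym (lookup∘update i base _)) ≼-refl
  ... | no  i≢j  =
    subst (λ y → y ≼⟨ _ , _ ⟩ lookup U i) (sym (lookup∘update′ i≢j base _)) (base-≼* {U} U∈ i)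

  update-base-nearer : ∀ {U} → TaxicabV₁ U → ∀ j → Nearer (base [ j ]≔ lookup U j)
  update-base-nearer {U} (U∈ , U-near) j =
    ≼*-nearer {E = E} {F} {base [ j ]≔ lookup U j} {U} (update-base-≼* {U} U∈ j) U-near

  base-TaxicabV₁ : TaxicabV₁ base
  base-TaxicabV₁ = (λ i → endpoint-InRange (base-endpoint i) (1≤n i)) ,
    ≼*-nearer {E = E} {F} {base} {E} (base-≼* {E} E∈) (subst (_≤ taxicab E F) (sym (taxicab-self E)) z≤n)

  farthest-in-direction : ∀ j → Farthest (lookup n j) (lookup base j) (λ y → Nearer (base [ j ]≔ y))
  farthest-in-direction j =
    farthest (base-endpoint j) (1≤n j) (λ y → Nearer (base [ j ]≔ y)) (λ _ → _ ≤? _)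
      (subst Nearer (sym ([]≔-lookup base j)) (nearer base-TaxicabV₁))

  reach : Fin (suc d) → ℕ
  reach j = far (farthest-in-direction j)

  landmark : Fin (suc d) → Point (suc d)
  landmark j = base [ j ]≔ reach j

  landmark-TaxicabV₁ : ∀ j → TaxicabV₁ (landmark j)
  landmark-TaxicabV₁ j =
    update-InGrid {base} j (inGrid base-TaxicabV₁) (far-InRange (farthest-in-direction j)) ,
    far-holds (farthest-in-direction j)

  reach-between : ∀ j {U} → TaxicabV₁ U → Between (lookup base j) (reach j) (lookup U j)
  reach-between j U∈ = far-bounds (farthest-in-direction j) (inGrid U∈ j) (update-base-nearer U∈ j)

  landmark-separates : ∀ j {U W} → TaxicabV₁ U → TaxicabV₁ W →
    taxicab U base ≡ taxicab W base → taxicab U (landmark j) ≡ taxicab W (landmark j) →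
    lookup U j ≡ lookup W j
  landmark-separates j {U} {W} U∈ W∈ same-base same-landmark =
    endpoint-injective (base-endpoint j) (inGrid U∈ j) (inGrid W∈ j) (+-cancel-crosswise
      (taxicab-update U base j (reach j))
      (subst₂ (λ l c → l + _ ≡ c + _) (sym same-landmark) (sym same-base)
        (taxicab-update W base j (reach j)))
      (trans (between⇒∣-∣-additive (reach-between j U∈))
        (sym (between⇒∣-∣-additive (reach-between j W∈)))))

  landmarks : List (Point (suc d))
  landmarks = base ∷ List.tabulate (landmark ∘ suc)

  landmarks-separate : ∀ {U W} → TaxicabV₁ U → TaxicabV₁ W →
    All (λ X → taxicab U X ≡ taxicab W X) landmarks → U ≡ W
  landmarks-separate {u ∷ U} {w ∷ W} U∈ W∈ (same-base ∷ same-landmarks) = cong₂ _∷_ u≡w U≡W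
    where
      U≡W : U ≡ W
      U≡W = lookup-ext λ k → landmark-separates (suc k) U∈ W∈ same-base (tabulate⁻ same-landmarks k)
      u≡w : u ≡ w
      u≡w = endpoint-injective (base-endpoint zero) (inGrid U∈ zero) (inGrid W∈ zero)
        (+-cancelʳ-≡ _ _ _ (trans same-base (cong (λ X → _ + taxicab X (tail base)) (sym U≡W))))

  landmarks-resolve : Resolving (V₁ n E F) landmarks
  landmarks-resolve = separating-list-resolves landmarks
    (TaxicabV₁⇒V₁ base-TaxicabV₁ ∷ tabulate⁺ (TaxicabV₁⇒V₁ ∘ landmark-TaxicabV₁ ∘ suc))
    V₁-Dist
    (λ A∈ B∈ → landmarks-separate (V₁⇒TaxicabV₁ A∈) (V₁⇒TaxicabV₁ B∈))

lemma3 : (d : ℕ) (n : Vec ℕ d) (E F : Point d) →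
    InGrid n E → InGrid n F → E ≢ F → ¬ Adj E F →
    MetricDimLe (V₁ n E F) d
lemma3 zero    [] [] [] _  _  E≢F _ = ⊥-elim (E≢F refl)
lemma3 (suc d) n  E  F  E∈ F∈ _   _ =
  landmarks , landmarks-resolve , ≤-reflexive (cong suc (length-tabulate _))
  where open Landmarks n E F E∈ F∈
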